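{- Let $G$ be a finite $2$-group such that $G/G_3$ is isomorphic to the group $32.040$. Then $G_3=1$.
   Context: $G'=[G,G]$, $G_3=[G,G']$. "$32.040$" is the group of order $32$ with that number in Hall–Senior, The groups of order $2^n$ ($n\le6$); one presentation is $\langle a_1,a_2,a_3: a_1^2=c_{12},\ a_2^2=c_{12}c_{13},\ a_3^2=c_{13},\ c_{23}=1,\ \text{commutators central}\rangle$ with $c_{ij}=[a_i,a_j]=a_i^{ -1}a_j^{ -1}a_ia_j$. -}

module Defs where

open import Level using (Level; _⊔_)
open import Algebra.Bundles using (Group)
open import Data.Bool using (Bool; true; false; _xor_; _∧_)
open import Data.Nat using (ℕ; _^_)
open import Data.Fin using (Fin)
open import Data.Product using (Σ; ∃; ∃₂; _×_; _,_)
open import Relation.Binary.PropositionalEquality using (_≡_; refl)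

module GroupNotions {c ℓ : Level} (G : Group c ℓ) where
  open Group G

  ⟦_,_⟧ : Carrier → Carrier → Carrier
  ⟦ x , y ⟧ = x ⁻¹ ∙ y ⁻¹ ∙ x ∙ y

  data Closure {p : Level} (S : Carrier → Set p) : Carrier → Set (c ⊔ ℓ ⊔ p) where
    gen  : ∀ {x} → S x → Closure S x
    one  : Closure S ε
    mul  : ∀ {x y} → Closure S x → Closure S y → Closure S (x ∙ y)
    inv  : ∀ {x} → Closure S x → Closure S (x ⁻¹)
    resp : ∀ {x y} → x ≈ y → Closure S x → Closure S y

  Derived : Carrier → Set (c ⊔ ℓ)
  Derived = Closure (λ x → ∃₂ λ a b → x ≈ ⟦ a , b ⟧)

  G₃ : Carrier → Set (c ⊔ ℓ)
  G₃ = Closure (λ x → ∃₂ λ a h → Derived h × x ≈ ⟦ a , h ⟧)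

  HasOrder : ℕ → Set (c ⊔ ℓ)
  HasOrder n = Σ (Fin n → Carrier) λ f →
                 (∀ i j → f i ≈ f j → i ≡ j) × (∀ x → ∃ λ i → f i ≈ x)

  IsFinite2Group : Set (c ⊔ ℓ)
  IsFinite2Group = ∃ λ k → HasOrder (2 ^ k)

  -- An isomorphism G/N ≅ (H, _·_) given by its lift f : G → H:
  -- f is a homomorphism, surjective, and f x ≡ f y exactly when x, y
  -- lie in the same coset of N, i.e. N (x⁻¹ ∙ y).  (This is precisely
  -- a well-defined, injective, surjective homomorphism out of G/N.)
  record QuotientIso {p : Level} (N : Carrier → Set p)
                     (H : Set) (_·_ : H → H → H) : Set (c ⊔ ℓ ⊔ p) where
    field
      f     : Carrier → H
      hom   : ∀ x y → f (x ∙ y) ≡ f x · f y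
      wd    : ∀ x y → N (x ⁻¹ ∙ y) → f x ≡ f y
      inj   : ∀ x y → f x ≡ f y → N (x ⁻¹ ∙ y)
      surj  : ∀ h → ∃ λ x → f x ≡ h

-- The group 32.040 of Hall–Senior, as a concrete group of order 32.
-- Elements (v , w) with v ∈ F₂³, w ∈ F₂², product
--   (v , w)(v' , w') = (v + v' , w + w' + β(v , v'))
-- with the bilinear form β(v,v') = (v₁v₁' + v₂v₂' + v₁v₂' ,
--                                   v₂v₂' + v₃v₃' + v₁v₃').
-- With a_i = (e_i , 0) one has a₁² = c₁₂, a₂² = c₁₂c₁₃, a₃² = c₁₃,
-- c₂₃ = 1, c₁₂ = (0,(1,0)), c₁₃ = (0,(0,1)) central (checked below).

record G32 : Set where
  constructor g32
  field
    v1 v2 v3 w1 w2 : Bool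

infixl 7 _·_
_·_ : G32 → G32 → G32
g32 a1 a2 a3 b1 b2 · g32 a1' a2' a3' b1' b2' =
  g32 (a1 xor a1') (a2 xor a2') (a3 xor a3')
      (b1 xor b1' xor (a1 ∧ a1') xor (a2 ∧ a2') xor (a1 ∧ a2'))
      (b2 xor b2' xor (a2 ∧ a2') xor (a3 ∧ a3') xor (a1 ∧ a3'))

e32 : G32
e32 = g32 false false false false false

inv32 : G32 → G32
inv32 (g32 a1 a2 a3 b1 b2) =
  g32 a1 a2 a3 (b1 xor (a1 ∧ a1) xor (a2 ∧ a2) xor (a1 ∧ a2))
               (b2 xor (a2 ∧ a2) xor (a3 ∧ a3) xor (a1 ∧ a3))

comm32 : G32 → G32 → G32
comm32 x y = inv32 x · inv32 y · x · y

x1 x2 x3 : G32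
x1 = g32 true false false false false
x2 = g32 false true false false false
x3 = g32 false false true false false

private
  c12 = comm32 x1 x2
  c13 = comm32 x1 x3
  chk1 : x1 · x1 ≡ c12
  chk1 = refl
  chk2 : x2 · x2 ≡ c12 · c13
  chk2 = refl
  chk3 : x3 · x3 ≡ c13
  chk3 = refl
  chk4 : comm32 x2 x3 ≡ e32
  chk4 = refl
  chk5 : c12 ≡ g32 false false false true false
  chk5 = refl
  chk6 : c13 ≡ g32 false false false false true
  chk6 = refl

-- Write G₄ = [G, G₃] and let a₁, a₂, a₃ lift the generators of 32.040. Modulo G₄ the subgroup G₃ is
-- central, so s ↦ [s , x] is a homomorphism on G′ depending only on s G₃. The lifted relations
-- P = a₁² ≡ [a₁,a₂], Q = a₃² ≡ [a₁,a₃], a₂² ≡ P Q and [a₂,a₃] ≡ 1 (mod G₃), fed into the identity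
-- [x²,y][y²,x] ≡ [[x,y],x][[x,y]⁻¹,y] (mod G₄), make P and Q central modulo G₄. As G′ is generated
-- by P, Q and G₃, this gives G₃ = [G, G′] ⊆ [G, G₃]. Finally, in a finite 2-group the upper central
-- series reaches G (by a class equation), so a subgroup N with N ⊆ [G, N] is trivial.

module Submission where

open import Defs
open import Algebra.Bundles using (Group)
open import Level using (Level; _⊔_)
open import Data.Nat using (ℕ; zero; suc; _≤_; _<_; z≤n; s≤s; _+_; _*_; _^_)
open import Data.Fin using (Fin)
open import Data.Product using (∃; _,_)
open import Relation.Binary.PropositionalEquality using (_≡_)

module FreeGroupWords where

  open import Data.Fin using (zero; suc)
  open import Data.Bool using (Bool; true; false; not)
  import Data.Bool.Properties as Bool
  import Data.Fin.Properties as Fin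
  open import Data.Product using (_×_; _,_)
  import Data.Product.Properties as Product
  open import Data.List using (List; []; _∷_; _++_; foldr)
  open import Relation.Binary.Definitions using (DecidableEquality)
  open import Relation.Nullary using (yes; no)

  infixl 7 _⊗_

  data Word (n : ℕ) : Set where
    var : Fin n → Word n
    e   : Word n
    _⊗_ : Word n → Word n → Word n
    ι   : Word n → Word n

  com : ∀ {n} → Word n → Word n → Word n
  com a b = ι a ⊗ ι b ⊗ a ⊗ b

  A : ∀ {n} → Word (suc n)
  A = var zero
  B : ∀ {n} → Word (suc (suc n))
  B = var (suc zero)
  C : ∀ {n} → Word (suc (suc (suc n)))
  C = var (suc (suc zero))
  D : ∀ {n} → Word (suc (suc (suc (suc n))))
  D = var (suc (suc (suc zero)))
  E : ∀ {n} → Word (suc (suc (suc (suc (suc n)))))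
  E = var (suc (suc (suc (suc zero))))

  -- A letter (i , b) stands for xᵢ if b is false and for xᵢ⁻¹ if b is true.
  Letter : ℕ → Set
  Letter n = Fin n × Bool

  _≟-letter_ : ∀ {n} → DecidableEquality (Letter n)
  _≟-letter_ = Product.≡-dec Fin._≟_ Bool._≟_

  invert : ∀ {n} → Letter n → Letter n
  invert (i , b) = i , not b

  invertWord : ∀ {n} → List (Letter n) → List (Letter n)
  invertWord []       = []
  invertWord (x ∷ xs) = invertWord xs ++ (invert x ∷ [])

  flatten : ∀ {n} → Word n → List (Letter n)
  flatten (var i) = (i , false) ∷ []
  flatten e       = []
  flatten (a ⊗ b) = flatten a ++ flatten b
  flatten (ι a)   = invertWord (flatten a)

  cons-reduced : ∀ {n} → Letter n → List (Letter n) → List (Letter n)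
  cons-reduced x []       = x ∷ []
  cons-reduced x (y ∷ ys) with y ≟-letter invert x
  ... | yes _ = ys
  ... | no  _ = x ∷ y ∷ ys

  reduce : ∀ {n} → List (Letter n) → List (Letter n)
  reduce = foldr cons-reduced []

  normalForm : ∀ {n} → Word n → List (Letter n)
  normalForm a = reduce (flatten a)

module FreeGroupSolver {c ℓ : Level} (G : Group c ℓ) where
  open Group G
  open FreeGroupWords
  open import Data.Bool using (true; false)
  open import Data.List using (List; []; _∷_; _++_)
  open import Data.Vec using (Vec; lookup)
  import Relation.Binary.PropositionalEquality as ≡
  open import Relation.Nullary using (yes; no)
  open import Algebra.Properties.Group G using (ε⁻¹≈ε; ⁻¹-involutive; ⁻¹-anti-homo-∙)
  open import Relation.Binary.Reasoning.Setoid setoid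

  module _ {n : ℕ} (ρ : Vec Carrier n) where
    ⟦_⟧ : Word n → Carrier
    ⟦ var i ⟧ = lookup ρ i
    ⟦ e ⟧     = ε
    ⟦ a ⊗ b ⟧ = ⟦ a ⟧ ∙ ⟦ b ⟧
    ⟦ ι a ⟧   = ⟦ a ⟧ ⁻¹

    ⟦_⟧ˡ : Letter n → Carrier
    ⟦ i , false ⟧ˡ = lookup ρ i
    ⟦ i , true ⟧ˡ  = lookup ρ i ⁻¹

    ⟦_⟧ʷ : List (Letter n) → Carrier
    ⟦ [] ⟧ʷ     = ε
    ⟦ x ∷ xs ⟧ʷ = ⟦ x ⟧ˡ ∙ ⟦ xs ⟧ʷ

    ⟦++⟧ : ∀ xs ys → ⟦ xs ++ ys ⟧ʷ ≈ ⟦ xs ⟧ʷ ∙ ⟦ ys ⟧ʷ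
    ⟦++⟧ []       ys = sym (identityˡ _)
    ⟦++⟧ (x ∷ xs) ys = trans (∙-congˡ (⟦++⟧ xs ys)) (sym (assoc _ _ _))

    ⟦invert⟧ : ∀ x → ⟦ invert x ⟧ˡ ≈ ⟦ x ⟧ˡ ⁻¹
    ⟦invert⟧ (i , false) = refl
    ⟦invert⟧ (i , true)  = sym (⁻¹-involutive _)

    ⟦invertWord⟧ : ∀ xs → ⟦ invertWord xs ⟧ʷ ≈ ⟦ xs ⟧ʷ ⁻¹
    ⟦invertWord⟧ []       = sym ε⁻¹≈ε
    ⟦invertWord⟧ (x ∷ xs) = begin
      ⟦ invertWord xs ++ (invert x ∷ []) ⟧ʷ  ≈⟨ ⟦++⟧ (invertWord xs) _ ⟩
      ⟦ invertWord xs ⟧ʷ ∙ (⟦ invert x ⟧ˡ ∙ ε) ≈⟨ ∙-cong (⟦invertWord⟧ xs) (trans (identityʳ _) (⟦invert⟧ x)) ⟩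
      ⟦ xs ⟧ʷ ⁻¹ ∙ ⟦ x ⟧ˡ ⁻¹                   ≈⟨ ⁻¹-anti-homo-∙ _ _ ⟨
      (⟦ x ⟧ˡ ∙ ⟦ xs ⟧ʷ) ⁻¹                    ∎

    ⟦flatten⟧ : ∀ a → ⟦ flatten a ⟧ʷ ≈ ⟦ a ⟧
    ⟦flatten⟧ (var i) = identityʳ _
    ⟦flatten⟧ e       = refl
    ⟦flatten⟧ (a ⊗ b) = trans (⟦++⟧ (flatten a) (flatten b)) (∙-cong (⟦flatten⟧ a) (⟦flatten⟧ b))
    ⟦flatten⟧ (ι a)   = trans (⟦invertWord⟧ (flatten a)) (⁻¹-cong (⟦flatten⟧ a))

    ⟦⟧ˡ-inverseʳ : ∀ x → ⟦ x ⟧ˡ ∙ ⟦ invert x ⟧ˡ ≈ ε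
    ⟦⟧ˡ-inverseʳ (i , false) = inverseʳ _
    ⟦⟧ˡ-inverseʳ (i , true)  = inverseˡ _

    ⟦cons-reduced⟧ : ∀ x ys → ⟦ cons-reduced x ys ⟧ʷ ≈ ⟦ x ⟧ˡ ∙ ⟦ ys ⟧ʷ
    ⟦cons-reduced⟧ x []       = refl
    ⟦cons-reduced⟧ x (y ∷ ys) with y ≟-letter invert x
    ... | yes ≡.refl = begin
      ⟦ ys ⟧ʷ                             ≈⟨ identityˡ _ ⟨
      ε ∙ ⟦ ys ⟧ʷ                         ≈⟨ ∙-congʳ (⟦⟧ˡ-inverseʳ x) ⟨
      (⟦ x ⟧ˡ ∙ ⟦ invert x ⟧ˡ) ∙ ⟦ ys ⟧ʷ ≈⟨ assoc _ _ _ ⟩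
      ⟦ x ⟧ˡ ∙ (⟦ invert x ⟧ˡ ∙ ⟦ ys ⟧ʷ) ∎
    ... | no _ = refl

    ⟦reduce⟧ : ∀ xs → ⟦ reduce xs ⟧ʷ ≈ ⟦ xs ⟧ʷ
    ⟦reduce⟧ []       = refl
    ⟦reduce⟧ (x ∷ xs) = trans (⟦cons-reduced⟧ x (reduce xs)) (∙-congˡ (⟦reduce⟧ xs))

    ⟦normalForm⟧ : ∀ a → ⟦ normalForm a ⟧ʷ ≈ ⟦ a ⟧
    ⟦normalForm⟧ a = trans (⟦reduce⟧ (flatten a)) (⟦flatten⟧ a)

  -- Words with the same free reduction are equal in every group; the premise is proved by refl.
  solve : ∀ {n} (a b : Word n) → normalForm a ≡ normalForm b → (ρ : Vec Carrier n) → ⟦ ρ ⟧ a ≈ ⟦ ρ ⟧ b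
  solve a b eq ρ = begin
    ⟦ ρ ⟧ a              ≈⟨ ⟦normalForm⟧ ρ a ⟨
    ⟦ ρ ⟧ʷ (normalForm a) ≡⟨ ≡.cong (⟦ ρ ⟧ʷ) eq ⟩
    ⟦ ρ ⟧ʷ (normalForm b) ≈⟨ ⟦normalForm⟧ ρ b ⟩
    ⟦ ρ ⟧ b              ∎

module PowerProducts where

  open import Data.Bool using (Bool; true; false)
  open import Data.Vec using (Vec; []; _∷_)

  ∏ : ∀ {a} {X : Set a} → (X → X → X) → X → ∀ {m} → Vec X m → Vec Bool m → X
  ∏ _*_ 1# []       []           = 1#
  ∏ _*_ 1# (x ∷ xs) (true ∷ bs)  = x * ∏ _*_ 1# xs bs
  ∏ _*_ 1# (x ∷ xs) (false ∷ bs) = ∏ _*_ 1# xs bs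

module Subgroups {c ℓ : Level} (G : Group c ℓ) where
  open Group G
  open GroupNotions G
  open FreeGroupWords
  open FreeGroupSolver G using (solve)
  open PowerProducts
  open import Data.Bool using (true; false)
  open import Data.Vec using (Vec; _∷_; [])
  open import Data.Vec.Relation.Unary.All using (All; _∷_; [])
  open import Data.Product using (_×_; _,_; ∃₂)
  open import Relation.Unary using (Pred; _⊆_)
  open import Relation.Binary.PropositionalEquality as ≡ using ()

  record IsSubgroup {p} (N : Pred Carrier p) : Set (c ⊔ ℓ ⊔ p) where
    field
      ∈-resp-≈  : ∀ {x y} → x ≈ y → N x → N y
      ε∈        : N ε
      ∙-closed  : ∀ {x y} → N x → N y → N (x ∙ y)
      ⁻¹-closed : ∀ {x} → N x → N (x ⁻¹)

  record IsNormal {p} (N : Pred Carrier p) : Set (c ⊔ ℓ ⊔ p) where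
    field
      isSubgroup  : IsSubgroup N
      conj-closed : ∀ {x} g → N x → N (g ⁻¹ ∙ x ∙ g)
    open IsSubgroup isSubgroup public

  ∏-closed : ∀ {q} {S : Pred Carrier q} → IsSubgroup S →
             ∀ {m} {xs : Vec Carrier m} → All S xs → ∀ bs → S (∏ _∙_ ε xs bs)
  ∏-closed S-subgroup []         []           = IsSubgroup.ε∈ S-subgroup
  ∏-closed S-subgroup (Sx ∷ Sxs) (true ∷ bs)  = IsSubgroup.∙-closed S-subgroup Sx (∏-closed S-subgroup Sxs bs)
  ∏-closed S-subgroup (Sx ∷ Sxs) (false ∷ bs) = ∏-closed S-subgroup Sxs bs

  ⟦⟧-cong : ∀ {x x′ y y′} → x ≈ x′ → y ≈ y′ → ⟦ x , y ⟧ ≈ ⟦ x′ , y′ ⟧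
  ⟦⟧-cong p q = ∙-cong (∙-cong (∙-cong (⁻¹-cong p) (⁻¹-cong q)) p) q

  ⟦⟧-conj : ∀ x y g → g ⁻¹ ∙ ⟦ x , y ⟧ ∙ g ≈ ⟦ g ⁻¹ ∙ x ∙ g , g ⁻¹ ∙ y ∙ g ⟧
  ⟦⟧-conj x y g = solve (ι C ⊗ com A B ⊗ C) (com (ι C ⊗ A ⊗ C) (ι C ⊗ B ⊗ C)) ≡.refl (x ∷ y ∷ g ∷ [])

  module _ {p} (S : Pred Carrier p) where

    Closure-isSubgroup : IsSubgroup (Closure S)
    Closure-isSubgroup = record { ∈-resp-≈ = resp ; ε∈ = one ; ∙-closed = mul ; ⁻¹-closed = inv }

    Closure-least : ∀ {q} {M : Pred Carrier q} → IsSubgroup M → S ⊆ M → Closure S ⊆ M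
    Closure-least {M = M} M-subgroup S⊆M = least
      where
      open IsSubgroup M-subgroup
      least : Closure S ⊆ M
      least (gen s)      = S⊆M s
      least one          = ε∈
      least (mul x y)    = ∙-closed (least x) (least y)
      least (inv x)      = ⁻¹-closed (least x)
      least (resp x≈y x) = ∈-resp-≈ x≈y (least x)

    Closure-isNormal : (∀ {x} g → S x → Closure S (g ⁻¹ ∙ x ∙ g)) → IsNormal (Closure S)
    Closure-isNormal S-conj = record { isSubgroup = Closure-isSubgroup ; conj-closed = conj }
      where
      conj : ∀ {x} g → Closure S x → Closure S (g ⁻¹ ∙ x ∙ g)
      conj g (gen s) = S-conj g s
      conj g one = resp (solve e (ι A ⊗ e ⊗ A) ≡.refl (g ∷ [])) one
      conj g (mul {x} {y} p q) =
        resp (solve ((ι A ⊗ B ⊗ A) ⊗ (ι A ⊗ C ⊗ A)) (ι A ⊗ (B ⊗ C) ⊗ A) ≡.refl (g ∷ x ∷ y ∷ []))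
             (mul (conj g p) (conj g q))
      conj g (inv {x} p) =
        resp (solve (ι (ι A ⊗ B ⊗ A)) (ι A ⊗ ι B ⊗ A) ≡.refl (g ∷ x ∷ [])) (inv (conj g p))
      conj g (resp x≈y p) = resp (∙-congʳ (∙-congˡ x≈y)) (conj g p)

  [G,_] : ∀ {p} → Pred Carrier p → Pred Carrier (c ⊔ ℓ ⊔ p)
  [G, N ] = Closure (λ x → ∃₂ λ a h → N h × x ≈ ⟦ a , h ⟧)

  [G,_]-isNormal : ∀ {p} {N : Pred Carrier p} → IsNormal N → IsNormal [G, N ]
  [G, N-normal ]-isNormal = Closure-isNormal _ λ { g (a , h , h∈N , x≈[a,h]) →
    gen (g ⁻¹ ∙ a ∙ g , g ⁻¹ ∙ h ∙ g , IsNormal.conj-closed N-normal g h∈N ,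
         trans (∙-congʳ (∙-congˡ x≈[a,h])) (⟦⟧-conj a h g)) }

  Derived-isNormal : IsNormal Derived
  Derived-isNormal = Closure-isNormal _ λ { g (a , b , x≈[a,b]) →
    gen (g ⁻¹ ∙ a ∙ g , g ⁻¹ ∙ b ∙ g , trans (∙-congʳ (∙-congˡ x≈[a,b])) (⟦⟧-conj a b g)) }

  G₃-isNormal : IsNormal G₃
  G₃-isNormal = [G, Derived-isNormal ]-isNormal

  G₃⊆Derived : G₃ ⊆ Derived
  G₃⊆Derived = Closure-least _ (Closure-isSubgroup _) λ { (a , h , _ , x≈[a,h]) → gen (a , h , x≈[a,h]) }

  module Quotient {p} {N : Pred Carrier p} (N-normal : IsNormal N) where
    open IsNormal N-normal

    infix 4 _≈ₙ_
    _≈ₙ_ : Carrier → Carrier → Set p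
    x ≈ₙ y = N (x ⁻¹ ∙ y)

    ≈⇒≈ₙ : ∀ {x y} → x ≈ y → x ≈ₙ y
    ≈⇒≈ₙ {x} x≈y = ∈-resp-≈ (trans (sym (inverseˡ x)) (∙-congˡ x≈y)) ε∈

    ∈⇒≈ₙε : ∀ {x} → N x → x ≈ₙ ε
    ∈⇒≈ₙε {x} x∈N = ∈-resp-≈ (solve (ι A) (ι A ⊗ e) ≡.refl (x ∷ [])) (⁻¹-closed x∈N)

    ≈ₙε⇒∈ : ∀ {x} → x ≈ₙ ε → N x
    ≈ₙε⇒∈ {x} x≈ₙε = ∈-resp-≈ (solve (ι (ι A ⊗ e)) A ≡.refl (x ∷ [])) (⁻¹-closed x≈ₙε)

    quotientGroup : Group c p
    quotientGroup = record
      { Carrier = Carrier ; _≈_ = _≈ₙ_ ; _∙_ = _∙_ ; ε = ε ; _⁻¹ = _⁻¹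
      ; isGroup = record
        { isMonoid = record
          { isSemigroup = record
            { isMagma = record
              { isEquivalence = record { refl = ≈⇒≈ₙ refl ; sym = ≈ₙ-sym ; trans = ≈ₙ-trans }
              ; ∙-cong = ∙-congₙ }
            ; assoc = λ x y z → ≈⇒≈ₙ (assoc x y z) }
          ; identity = (λ x → ≈⇒≈ₙ (identityˡ x)) , (λ x → ≈⇒≈ₙ (identityʳ x)) }
        ; inverse = (λ x → ≈⇒≈ₙ (inverseˡ x)) , (λ x → ≈⇒≈ₙ (inverseʳ x))
        ; ⁻¹-cong = ⁻¹-congₙ } }
      where
      ≈ₙ-sym : ∀ {x y} → x ≈ₙ y → y ≈ₙ x
      ≈ₙ-sym {x} {y} p = ∈-resp-≈ (solve (ι (ι A ⊗ B)) (ι B ⊗ A) ≡.refl (x ∷ y ∷ [])) (⁻¹-closed p)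
      ≈ₙ-trans : ∀ {x y z} → x ≈ₙ y → y ≈ₙ z → x ≈ₙ z
      ≈ₙ-trans {x} {y} {z} p q =
        ∈-resp-≈ (solve ((ι A ⊗ B) ⊗ (ι B ⊗ C)) (ι A ⊗ C) ≡.refl (x ∷ y ∷ z ∷ [])) (∙-closed p q)
      ∙-congₙ : ∀ {x x′ y y′} → x ≈ₙ x′ → y ≈ₙ y′ → x ∙ y ≈ₙ x′ ∙ y′
      ∙-congₙ {x} {x′} {y} {y′} p q =
        ∈-resp-≈ (solve ((ι C ⊗ (ι A ⊗ B) ⊗ C) ⊗ (ι C ⊗ D)) (ι (A ⊗ C) ⊗ (B ⊗ D)) ≡.refl (x ∷ x′ ∷ y ∷ y′ ∷ []))
                 (∙-closed (conj-closed y p) q)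
      ⁻¹-congₙ : ∀ {x y} → x ≈ₙ y → x ⁻¹ ≈ₙ y ⁻¹
      ⁻¹-congₙ {x} {y} p =
        ∈-resp-≈ (solve (ι (ι A) ⊗ ι (ι A ⊗ B) ⊗ ι A) (ι (ι A) ⊗ ι B) ≡.refl (x ∷ y ∷ []))
                 (conj-closed (x ⁻¹) (⁻¹-closed p))

  module Centre {p} {N : Pred Carrier p} (N-normal : IsNormal N) where
    open IsNormal N-normal

    ⟦⟧-swap : ∀ {x y} → N ⟦ x , y ⟧ → N ⟦ y , x ⟧
    ⟦⟧-swap {x} {y} p = ∈-resp-≈ (solve (ι (com A B)) (com B A) ≡.refl (x ∷ y ∷ [])) (⁻¹-closed p)

    ⟦∙,⟧ : ∀ x y g → ⟦ x ∙ y , g ⟧ ≈ (y ⁻¹ ∙ ⟦ x , g ⟧ ∙ y) ∙ ⟦ y , g ⟧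
    ⟦∙,⟧ x y g = solve (com (A ⊗ B) C) ((ι B ⊗ com A C ⊗ B) ⊗ com B C) ≡.refl (x ∷ y ∷ g ∷ [])

    ⟦⁻¹,⟧ : ∀ x g → ⟦ x ⁻¹ , g ⟧ ≈ (x ⁻¹) ⁻¹ ∙ ⟦ x , g ⟧ ⁻¹ ∙ x ⁻¹
    ⟦⁻¹,⟧ x g = solve (com (ι A) B) (ι (ι A) ⊗ ι (com A B) ⊗ ι A) ≡.refl (x ∷ g ∷ [])

    -- The preimage of the centraliser of x N in G / N.
    Centraliser : Carrier → Pred Carrier p
    Centraliser x g = N ⟦ g , x ⟧

    Centraliser-isSubgroup : ∀ x → IsSubgroup (Centraliser x)
    Centraliser-isSubgroup x = record
      { ∈-resp-≈  = λ g≈h → ∈-resp-≈ (⟦⟧-cong g≈h refl)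
      ; ε∈        = ∈-resp-≈ (solve e (com e A) ≡.refl (x ∷ [])) ε∈
      ; ∙-closed  = λ {g} {h} p q → ∈-resp-≈ (sym (⟦∙,⟧ g h x)) (∙-closed (conj-closed h p) q)
      ; ⁻¹-closed = λ {g} p → ∈-resp-≈ (sym (⟦⁻¹,⟧ g x)) (conj-closed (g ⁻¹) (⁻¹-closed p)) }

    -- The preimage of the centre of G / N.
    UpperCentre : Pred Carrier (c ⊔ p)
    UpperCentre x = ∀ g → N ⟦ x , g ⟧

    ⊆UpperCentre : N ⊆ UpperCentre
    ⊆UpperCentre {x} x∈N g = ∈-resp-≈ (solve (ι A ⊗ (ι B ⊗ A ⊗ B)) (com A B) ≡.refl (x ∷ g ∷ []))
                                      (∙-closed (⁻¹-closed x∈N) (conj-closed g x∈N))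

    UpperCentre-isNormal : IsNormal UpperCentre
    UpperCentre-isNormal = record
      { isSubgroup = record
        { ∈-resp-≈  = λ x≈y p g → ∈-resp-≈ (⟦⟧-cong x≈y refl) (p g)
        ; ε∈        = λ g → ∈-resp-≈ (solve e (com e A) ≡.refl (g ∷ [])) ε∈
        ; ∙-closed  = λ {x} {y} p q g → ∈-resp-≈ (sym (⟦∙,⟧ x y g)) (∙-closed (conj-closed y (p g)) (q g))
        ; ⁻¹-closed = λ {x} p g → ∈-resp-≈ (sym (⟦⁻¹,⟧ x g)) (conj-closed (x ⁻¹) (⁻¹-closed (p g))) }
      ; conj-closed = λ {x} h p g →
          ∈-resp-≈ (solve (ι A ⊗ com B (A ⊗ C ⊗ ι A) ⊗ A) (com (ι A ⊗ B ⊗ A) C) ≡.refl (h ∷ x ∷ g ∷ []))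
                   (conj-closed h (p (h ∙ g ∙ h ⁻¹))) }

    [G,_]⊆ : ∀ {q} {M : Pred Carrier q} → M ⊆ UpperCentre → [G, M ] ⊆ N
    [G, M⊆Z⁺ ]⊆ = Closure-least _ isSubgroup λ { (a , h , h∈M , x≈[a,h]) →
      ∈-resp-≈ (sym x≈[a,h]) (⟦⟧-swap (M⊆Z⁺ h∈M a)) }

module PowersOfTwo where

  open import Data.Nat
  open import Data.Nat.Properties
  open import Data.Nat.Divisibility
  open import Data.Nat.Coprimality using (Coprime; coprime-divisor)
  open import Data.Product using (∃; _,_)
  open import Data.Empty using (⊥-elim)
  open import Relation.Nullary using (yes; no; ¬_)
  open import Relation.Binary.PropositionalEquality
  open import Data.Nat.Solver using (module +-*-Solver)
  open +-*-Solver using (solve; _:*_; _:=_; con)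

  ∤2⇒coprime-2 : ∀ d → ¬ 2 ∣ d → Coprime d 2
  ∤2⇒coprime-2 d 2∤d {zero}            (_ , 0∣2)   with () ← 0∣⇒≡0 0∣2
  ∤2⇒coprime-2 d 2∤d {suc zero}        _           = refl
  ∤2⇒coprime-2 d 2∤d {suc (suc zero)}  (2∣d , _)   = ⊥-elim (2∤d 2∣d)
  ∤2⇒coprime-2 d 2∤d {suc (suc (suc i))} (_ , i∣2) with ∣⇒≤ i∣2
  ... | s≤s (s≤s ())

  ∣2^⇒≡2^ : ∀ k d → d ∣ 2 ^ k → ∃ λ t → d ≡ 2 ^ t
  ∣2^⇒≡2^ zero    d d∣1 = 0 , ∣1⇒≡1 d∣1
  ∣2^⇒≡2^ (suc k) d d∣2^1+k with 2 ∣? d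
  ... | no 2∤d = ∣2^⇒≡2^ k d (coprime-divisor (∤2⇒coprime-2 d 2∤d) d∣2^1+k)
  ... | yes (divides q d≡q*2) with ∣2^⇒≡2^ k q q∣2^k
    where
    q∣2^k : q ∣ 2 ^ k
    q∣2^k = *-cancelʳ-∣ 2 (subst (_∣ 2 ^ k * 2) d≡q*2 (subst (d ∣_) (*-comm 2 (2 ^ k)) d∣2^1+k))
  ...   | t , q≡2^t = suc t , trans d≡q*2 (trans (cong (_* 2) q≡2^t) (*-comm (2 ^ t) 2))

  2^-cancel-< : ∀ s k → 2 ^ s < 2 ^ k → s < k
  2^-cancel-< s k 2^s<2^k with s <? k
  ... | yes s<k = s<k
  ... | no s≮k  = ⊥-elim (<⇒≱ 2^s<2^k (^-monoʳ-≤ 2 (≮⇒≥ s≮k)))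

  2^-split : ∀ a b → a ≤ b → ∃ λ r → 2 ^ b ≡ 2 ^ r * 2 ^ a
  2^-split a b a≤b with m≤n⇒∃[o]m+o≡n a≤b
  ... | r , a+r≡b = r , trans (cong (2 ^_) (trans (sym a+r≡b) (+-comm a r))) (^-distribˡ-+-* 2 r a)

  2^1+s∣ : ∀ m t k s → t < k → m * 2 ^ t ≡ 2 ^ k * 2 ^ s → 2 ^ suc s ∣ m
  2^1+s∣ m t k s t<k eq with 2^-split (suc t) k t<k
  ... | r , 2^k≡ = divides (2 ^ r) (*-cancelʳ-≡ m (2 ^ r * 2 ^ suc s) (2 ^ t) {{m^n≢0 2 t}} (begin
      m * 2 ^ t                   ≡⟨ eq ⟩
      2 ^ k * 2 ^ s               ≡⟨ cong (_* 2 ^ s) 2^k≡ ⟩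
      2 ^ r * (2 * 2 ^ t) * 2 ^ s ≡⟨ solve 3 (λ x y z → x :* (con 2 :* y) :* z := x :* (con 2 :* z) :* y) refl
                                            (2 ^ r) (2 ^ t) (2 ^ s) ⟩
      2 ^ r * (2 * 2 ^ s) * 2 ^ t ∎))
    where open ≡-Reasoning

module FinSum where

  open import Data.Nat
  open import Data.Nat.Properties
  open import Data.Fin using (Fin; zero; suc)
  open import Data.Product using (∃; _,_)
  open import Relation.Binary.PropositionalEquality using (_≡_; refl; cong; subst; sym; trans)
  open import Algebra.Properties.CommutativeMonoid.Sum +-0-commutativeMonoid public
    using (sum; ∑-comm; ∑-permute; ∑-distrib-+; sum-cong-≗)

  sum-≥-term : ∀ {m} (g : Fin m → ℕ) i → g i ≤ sum g
  sum-≥-term g zero    = m≤m+n _ _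
  sum-≥-term g (suc i) = ≤-trans (sum-≥-term (λ j → g (suc j)) i) (m≤n+m _ (g zero))

  sum>0⇒term>0 : ∀ {m} (g : Fin m → ℕ) → 0 < sum g → ∃ λ i → 0 < g i
  sum>0⇒term>0 {suc m} g sum>0 with g zero in g0≡
  ... | suc _ = zero , subst (0 <_) (sym g0≡) (s≤s z≤n)
  ... | zero with sum>0⇒term>0 (λ j → g (suc j)) sum>0
  ...   | i , gi>0 = suc i , gi>0

  sum-*ʳ : ∀ {m} c (g : Fin m → ℕ) → sum (λ i → g i * c) ≡ sum g * c
  sum-*ʳ {zero}  c g = refl
  sum-*ʳ {suc m} c g = trans (cong (g zero * c +_) (sum-*ʳ c (λ j → g (suc j)))) (sym (*-distribʳ-+ c (g zero) _))

  sum-const : ∀ {m} c → sum {m} (λ _ → c) ≡ m * c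
  sum-const {zero}  c = refl
  sum-const {suc m} c = cong (c +_) (sum-const {m} c)

  sum-mono-≤ : ∀ {m} (g h : Fin m → ℕ) → (∀ i → g i ≤ h i) → sum g ≤ sum h
  sum-mono-≤ {zero}  g h g≤h = z≤n
  sum-mono-≤ {suc m} g h g≤h = +-mono-≤ (g≤h zero) (sum-mono-≤ (λ j → g (suc j)) (λ j → h (suc j)) (λ j → g≤h (suc j)))

module Counting {c ℓ : Level} (G : Group c ℓ) {n : ℕ} (enum : Fin n → Group.Carrier G)
                (enum-injective : ∀ i j → Group._≈_ G (enum i) (enum j) → i ≡ j)
                (enum-surjective : ∀ x → ∃ λ i → Group._≈_ G (enum i) x) where
  open Group G
  open GroupNotions G using (⟦_,_⟧)
  open Subgroups G
  open FreeGroupWords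
  open FreeGroupSolver G using (solve)
  open FinSum
  open import Data.Nat.Properties
    using (≤-refl; ≤-trans; ≤-pred; n≤0⇒n≡0; *-zeroʳ; +-identityʳ; +-comm; +-monoˡ-≤; +-monoʳ-≤; m≤m+n; *-identityʳ)
  open import Data.Nat.Divisibility using (_∣_; ∣-refl; _∣0; ∣m∣n⇒∣m+n)
  import Data.Fin.Properties as Fin
  open import Data.Fin.Permutation using (Permutation; permutation)
  open import Data.Vec using (_∷_; [])
  open import Data.Product using (_×_; proj₁; proj₂)
  open import Data.Unit using (⊤; tt)
  open import Function using (_∘_)
  open import Data.Empty using (⊥-elim)
  open import Relation.Nullary using (Dec; yes; no; ¬_)
  open import Relation.Nullary.Decidable using (_×-dec_; ¬?)
  open import Relation.Unary using (Pred; Decidable; _⊆_)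
  open import Relation.Binary using (Rel; IsEquivalence) renaming (Decidable to Decidable₂)
  open import Relation.Binary.PropositionalEquality as ≡ using ()

  χ : ∀ {p} {A : Set p} → Dec A → ℕ
  χ (yes _) = 1
  χ (no _)  = 0

  χ-cong : ∀ {p q} {A : Set p} {B : Set q} → (A → B) → (B → A) → (a? : Dec A) (b? : Dec B) → χ a? ≡ χ b?
  χ-cong A→B B→A (yes a) (yes b) = ≡.refl
  χ-cong A→B B→A (yes a) (no ¬b) = ⊥-elim (¬b (A→B a))
  χ-cong A→B B→A (no ¬a) (yes b) = ⊥-elim (¬a (B→A b))
  χ-cong A→B B→A (no ¬a) (no ¬b) = ≡.refl

  χ>0⇒ : ∀ {p} {A : Set p} (a? : Dec A) → 0 < χ a? → A
  χ>0⇒ (yes a) _ = a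

  χ-yes : ∀ {p} {A : Set p} (a? : Dec A) → A → χ a? ≡ 1
  χ-yes (yes _) _ = ≡.refl
  χ-yes (no ¬a) a = ⊥-elim (¬a a)

  χ-no : ∀ {p} {A : Set p} (a? : Dec A) → ¬ A → χ a? ≡ 0
  χ-no (yes a) ¬a = ⊥-elim (¬a a)
  χ-no (no _) _   = ≡.refl

  index : Carrier → Fin n
  index x = proj₁ (enum-surjective x)

  enum-index : ∀ x → enum (index x) ≈ x
  enum-index x = proj₂ (enum-surjective x)

  index-enum : ∀ {i x} → enum i ≈ x → index x ≡ i
  index-enum {i} {x} p = enum-injective (index x) i (trans (enum-index x) (sym p))

  _≟_ : ∀ x y → Dec (x ≈ y)
  x ≟ y with index x Fin.≟ index y
  ... | yes ix≡iy = yes (trans (sym (enum-index x)) (trans (reflexive (≡.cong enum ix≡iy)) (enum-index y)))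
  ... | no ix≢iy  = no (λ x≈y → ix≢iy (index-enum (trans (enum-index y) (sym x≈y))))

  module _ {p} {P : Pred Carrier p} (P-resp : ∀ {x y} → x ≈ y → P x → P y) (P? : Decidable P) where

    all? : Dec (∀ x → P x)
    all? with Fin.all? (λ i → P? (enum i))
    ... | yes all = yes (λ x → P-resp (enum-index x) (all (index x)))
    ... | no ¬all = no (λ all → ¬all (λ i → all (enum i)))

    any? : Dec (∃ P)
    any? with Fin.any? (λ i → P? (enum i))
    ... | yes (i , Pi) = yes (enum i , Pi)
    ... | no ¬any      = no (λ { (x , Px) → ¬any (index x , P-resp (sym (enum-index x)) Px) })

  count : ∀ {p} {P : Pred Carrier p} → Decidable P → ℕ
  count P? = sum (λ i → χ (P? (enum i)))

  ∑-bijection : (σ τ : Carrier → Carrier) → (∀ x → σ (τ x) ≈ x) → (∀ x → τ (σ x) ≈ x) →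
                (∀ {x y} → x ≈ y → σ x ≈ σ y) → (∀ {x y} → x ≈ y → τ x ≈ τ y) →
                (h : Carrier → ℕ) → (∀ {x y} → x ≈ y → h x ≡ h y) →
                sum (λ i → h (enum i)) ≡ sum (λ i → h (σ (enum i)))
  ∑-bijection σ τ στ τσ σ-cong τ-cong h h-cong =
    ≡.trans (∑-permute (λ i → h (enum i)) π) (sum-cong-≗ (λ i → h-cong (enum-index (σ (enum i)))))
    where
    π : Permutation n n
    π = permutation (λ i → index (σ (enum i))) (λ i → index (τ (enum i)))
          (λ i → index-enum (sym (trans (σ-cong (enum-index _)) (στ (enum i)))))
          (λ i → index-enum (sym (trans (τ-cong (enum-index _)) (τσ (enum i)))))

  count-all : count {P = λ _ → ⊤} (λ _ → yes tt) ≡ n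
  count-all = ≡.trans (sum-const {n} 1) (*-identityʳ n)

  count-complement : ∀ {p} {P : Pred Carrier p} (P? : Decidable P) → count P? + count (λ x → ¬? (P? x)) ≡ n
  count-complement P? = ≡.trans (≡.sym (∑-distrib-+ (λ i → χ (P? (enum i))) (λ i → χ (¬? (P? (enum i))))))
                          (≡.trans (sum-cong-≗ (λ i → χ+χ¬ (P? (enum i)))) count-all)
    where
    χ+χ¬ : ∀ {p} {A : Set p} (a? : Dec A) → χ a? + χ (¬? a?) ≡ 1
    χ+χ¬ (yes _) = ≡.refl
    χ+χ¬ (no _)  = ≡.refl

  count-mono : ∀ {p q} {P : Pred Carrier p} {Q : Pred Carrier q} (P? : Decidable P) (Q? : Decidable Q) →
               P ⊆ Q → count P? ≤ count Q?
  count-mono {P = P} {Q = Q} P? Q? P⊆Q = sum-mono-≤ _ _ (λ i → χ-mono (P? (enum i)) (Q? (enum i)))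
    where
    χ-mono : ∀ {x} (a? : Dec (P x)) (b? : Dec (Q x)) → χ a? ≤ χ b?
    χ-mono (yes a) (yes b) = ≤-refl
    χ-mono (yes a) (no ¬b) = ⊥-elim (¬b (P⊆Q a))
    χ-mono (no _)  _       = z≤n

  count≤n : ∀ {p} {P : Pred Carrier p} (P? : Decidable P) → count P? ≤ n
  count≤n P? = ≡.subst (count P? ≤_) (count-complement P?) (m≤m+n (count P?) _)

  count<n : ∀ {p} {P : Pred Carrier p} (P? : Decidable P) → (∀ {x y} → x ≈ y → P x → P y) →
            ¬ (∀ x → P x) → count P? < n
  count<n {P = P} P? P-resp ¬all
    with Fin.¬∀⟶∃¬ n (λ i → P (enum i)) (λ i → P? (enum i)) (λ all → ¬all (λ x → P-resp (enum-index x) (all (index x))))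
  ... | i , ¬Pi = ≡.subst (count P? <_) (count-complement P?)
                    (≡.subst (_≤ count P? + count ¬P?) (+-comm (count P?) 1) (+-monoʳ-≤ (count P?) 1≤#¬P))
    where
    ¬P? = λ x → ¬? (P? x)
    1≤#¬P : 1 ≤ count ¬P?
    1≤#¬P = ≡.subst (_≤ count ¬P?) (χ-yes (¬P? (enum i)) ¬Pi) (sum-≥-term (λ j → χ (¬P? (enum j))) i)

  module _ {r} {R : Rel Carrier r} (R? : Decidable₂ R) (R-equiv : IsEquivalence R) (d : ℕ) where
    open IsEquivalence R-equiv renaming (refl to R-refl; sym to R-sym; trans to R-trans)

    ∣-count-of-classes : ∀ {p} {P : Pred Carrier p} (P? : Decidable P) → (∀ {x y} → P x → R x y → P y) →
                         (∀ x → P x → d ∣ count (R? x)) → d ∣ count P?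
    ∣-count-of-classes P? closed d∣class = go (count P?) P? ≤-refl closed d∣class
      where
      -- Induction on a bound for count P?, removing the class of one element of P at a time.
      go : ∀ bound {p} {P : Pred Carrier p} (P? : Decidable P) → count P? ≤ bound →
           (∀ {x y} → P x → R x y → P y) → (∀ x → P x → d ∣ count (R? x)) → d ∣ count P?
      go zero    P? #P≤0 closed d∣class = ≡.subst (d ∣_) (≡.sym (n≤0⇒n≡0 #P≤0)) (d ∣0)
      go (suc b) {P = P} P? #P≤1+b closed d∣class with count P? in #P≡
      ... | zero = d ∣0
      ... | suc _ with sum>0⇒term>0 (λ i → χ (P? (enum i))) (≡.subst (0 <_) (≡.sym #P≡) (s≤s z≤n))
      ...   | i , χ>0 = ≡.subst (d ∣_) (≡.trans (≡.sym split) #P≡)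
                          (∣m∣n⇒∣m+n (d∣class x₀ Px₀) (go b P′? #P′≤b closed′ (λ x → d∣class x ∘ proj₁)))
        where
        x₀ = enum i
        Px₀ : P x₀
        Px₀ = χ>0⇒ (P? x₀) χ>0
        P′ : Pred Carrier _
        P′ y = P y × ¬ R x₀ y
        P′? : Decidable P′
        P′? y = P? y ×-dec ¬? (R? x₀ y)
        χ-split : ∀ y → χ (P? y) ≡ χ (R? x₀ y) + χ (P′? y)
        χ-split y with P? y | R? x₀ y
        ... | yes _  | yes _  = ≡.refl
        ... | yes _  | no _   = ≡.refl
        ... | no ¬Py | yes Ry = ⊥-elim (¬Py (closed Px₀ Ry))
        ... | no _   | no _   = ≡.refl
        split : count P? ≡ count (R? x₀) + count P′?
        split = ≡.trans (sum-cong-≗ (λ j → χ-split (enum j)))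
                        (∑-distrib-+ (λ j → χ (R? x₀ (enum j))) (λ j → χ (P′? (enum j))))
        1≤#class : 1 ≤ count (R? x₀)
        1≤#class = ≡.subst (_≤ count (R? x₀)) (χ-yes (R? x₀ x₀) R-refl) (sum-≥-term (λ j → χ (R? x₀ (enum j))) i)
        #P′≤b : count P′? ≤ b
        #P′≤b = ≤-pred (≤-trans (≡.subst (suc (count P′?) ≤_) (≡.trans (≡.sym split) #P≡)
                                         (+-monoˡ-≤ (count P′?) 1≤#class)) #P≤1+b)
        closed′ : ∀ {x y} → P′ x → R x y → P′ y
        closed′ (Px , ¬Rx₀x) Rxy = closed Px Rxy , λ Rx₀y → ¬Rx₀x (R-trans Rx₀y (R-sym Rxy))

  module _ {q} {H : Pred Carrier q} (H-subgroup : IsSubgroup H) (H? : Decidable H) where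
    open IsSubgroup H-subgroup

    SameCoset : Rel Carrier q
    SameCoset x y = H (x ⁻¹ ∙ y)

    SameCoset-isEquivalence : IsEquivalence SameCoset
    SameCoset-isEquivalence = record
      { refl  = λ {x} → ∈-resp-≈ (sym (inverseˡ x)) ε∈
      ; sym   = λ {x} {y} p → ∈-resp-≈ (solve (ι (ι A ⊗ B)) (ι B ⊗ A) ≡.refl (x ∷ y ∷ [])) (⁻¹-closed p)
      ; trans = λ {x} {y} {z} p q →
          ∈-resp-≈ (solve ((ι A ⊗ B) ⊗ (ι B ⊗ C)) (ι A ⊗ C) ≡.refl (x ∷ y ∷ z ∷ [])) (∙-closed p q) }

    count-coset : ∀ x → count (λ y → H? (x ⁻¹ ∙ y)) ≡ count H?
    count-coset x = ≡.trans
      (∑-bijection (x ∙_) (x ⁻¹ ∙_)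
         (λ y → solve (A ⊗ (ι A ⊗ B)) B ≡.refl (x ∷ y ∷ []))
         (λ y → solve (ι A ⊗ (A ⊗ B)) B ≡.refl (x ∷ y ∷ []))
         ∙-congˡ ∙-congˡ (λ y → χ (H? (x ⁻¹ ∙ y)))
         (λ y≈y′ → χ-cong (∈-resp-≈ (∙-congˡ y≈y′)) (∈-resp-≈ (∙-congˡ (sym y≈y′))) (H? _) (H? _)))
      (sum-cong-≗ λ i → χ-cong (∈-resp-≈ (x⁻¹∙[x∙y]≈y (enum i))) (∈-resp-≈ (sym (x⁻¹∙[x∙y]≈y (enum i)))) (H? _) (H? _))
      where
      x⁻¹∙[x∙y]≈y : ∀ y → x ⁻¹ ∙ (x ∙ y) ≈ y
      x⁻¹∙[x∙y]≈y y = solve (ι A ⊗ (A ⊗ B)) B ≡.refl (x ∷ y ∷ [])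

    lagrange : count H? ∣ n
    lagrange = ≡.subst (count H? ∣_) count-all
      (∣-count-of-classes (λ x y → H? (x ⁻¹ ∙ y)) SameCoset-isEquivalence (count H?) (λ _ → yes tt) _
         (λ x _ → ≡.subst (count H? ∣_) (≡.sym (count-coset x)) ∣-refl))

  module _ {k : ℕ} (n≡2^k : n ≡ 2 ^ k) where
    open PowersOfTwo

    subgroup-order : ∀ {q} {H : Pred Carrier q} → IsSubgroup H → (H? : Decidable H) → ∃ λ s → count H? ≡ 2 ^ s
    subgroup-order H-subgroup H? = ∣2^⇒≡2^ k (count H?) (≡.subst (count H? ∣_) n≡2^k (lagrange H-subgroup H?))

    proper-subgroup-order : ∀ {q} {H : Pred Carrier q} → IsSubgroup H → (H? : Decidable H) →
                            ¬ (∀ x → H x) → ∃ λ s → count H? ≡ 2 ^ s × s < k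
    proper-subgroup-order H-subgroup H? H-proper with subgroup-order H-subgroup H?
    ... | s , #H≡2^s = s , #H≡2^s , 2^-cancel-< s k
          (≡.subst₂ _<_ #H≡2^s n≡2^k (count<n H? (IsSubgroup.∈-resp-≈ H-subgroup) H-proper))

  module ClassEquationModulo {p} {Z : Pred Carrier p} (Z-normal : IsNormal Z) (Z? : Decidable Z) where
    open IsNormal Z-normal renaming (isSubgroup to Z-subgroup)
    open Centre Z-normal

    UpperCentre? : Decidable UpperCentre
    UpperCentre? x = all? (λ g≈h → ∈-resp-≈ (⟦⟧-cong refl g≈h)) (λ g → Z? ⟦ x , g ⟧)

    Centraliser? : ∀ x → Decidable (Centraliser x)
    Centraliser? x g = Z? ⟦ g , x ⟧

    Conjugate : Rel Carrier (c ⊔ p)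
    Conjugate x y = ∃ λ g → Z ((g ⁻¹ ∙ x ∙ g) ⁻¹ ∙ y)

    Conjugate? : Decidable₂ Conjugate
    Conjugate? x y = any? (λ g≈h → ∈-resp-≈ (∙-congʳ (⁻¹-cong (∙-cong (∙-congʳ (⁻¹-cong g≈h)) g≈h))))
                          (λ g → Z? ((g ⁻¹ ∙ x ∙ g) ⁻¹ ∙ y))

    Conjugate-isEquivalence : IsEquivalence Conjugate
    Conjugate-isEquivalence = record
      { refl  = λ {x} → ε , ∈-resp-≈ (solve e (ι (ι e ⊗ A ⊗ e) ⊗ A) ≡.refl (x ∷ [])) ε∈
      ; sym   = λ { {x} {y} (g , p) → g ⁻¹ ,
          ∈-resp-≈ (solve (ι (ι A) ⊗ ι (ι (ι A ⊗ B ⊗ A) ⊗ C) ⊗ ι A) (ι (ι (ι A) ⊗ C ⊗ ι A) ⊗ B) ≡.refl (g ∷ x ∷ y ∷ []))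
                   (conj-closed (g ⁻¹) (⁻¹-closed p)) }
      ; trans = λ { {x} {y} {z} (g , p) (h , q) → g ∙ h ,
          ∈-resp-≈ (solve ((ι B ⊗ (ι (ι A ⊗ C ⊗ A) ⊗ D) ⊗ B) ⊗ (ι (ι B ⊗ D ⊗ B) ⊗ E))
                          (ι (ι (A ⊗ B) ⊗ C ⊗ (A ⊗ B)) ⊗ E) ≡.refl (g ∷ h ∷ x ∷ y ∷ z ∷ []))
                   (∙-closed (conj-closed h p) q) } }

    UpperCentre-closed : ∀ {x y} → Conjugate x y → UpperCentre y → UpperCentre x
    UpperCentre-closed {x} {y} (g , p) y∈Z⁺ =
      Z⁺.∈-resp-≈ (solve (ι (ι A) ⊗ (C ⊗ ι (ι (ι A ⊗ B ⊗ A) ⊗ C)) ⊗ ι A) B ≡.refl (g ∷ x ∷ y ∷ []))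
                  (Z⁺.conj-closed (g ⁻¹) (Z⁺.∙-closed y∈Z⁺ (Z⁺.⁻¹-closed (⊆UpperCentre p))))
      where module Z⁺ = IsNormal UpperCentre-isNormal

    module _ (x : Carrier) where

      conj : Carrier → Carrier
      conj g = g ⁻¹ ∙ x ∙ g

      conj-fibre→ : ∀ {g₀ y} → Z (conj g₀ ⁻¹ ∙ y) → ∀ g → Z (conj g ⁻¹ ∙ y) → Centraliser x (g ∙ g₀ ⁻¹)
      conj-fibre→ {g₀} {y} p g q =
        ∈-resp-≈ (solve (ι (ι B) ⊗ ((ι (ι A ⊗ C ⊗ A) ⊗ D) ⊗ ι (ι (ι B ⊗ C ⊗ B) ⊗ D)) ⊗ ι B)
                        (com (A ⊗ ι B) C) ≡.refl (g ∷ g₀ ∷ x ∷ y ∷ []))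
                 (conj-closed (g₀ ⁻¹) (∙-closed q (⁻¹-closed p)))

      conj-fibre← : ∀ {g₀ y} → Z (conj g₀ ⁻¹ ∙ y) → ∀ g → Centraliser x (g ∙ g₀ ⁻¹) → Z (conj g ⁻¹ ∙ y)
      conj-fibre← {g₀} {y} p g q =
        ∈-resp-≈ (solve ((ι B ⊗ com (A ⊗ ι B) C ⊗ B) ⊗ (ι (ι B ⊗ C ⊗ B) ⊗ D))
                        (ι (ι A ⊗ C ⊗ A) ⊗ D) ≡.refl (g ∷ g₀ ∷ x ∷ y ∷ []))
                 (∙-closed (conj-closed g₀ q) p)

      count-fibre : ∀ y → sum (λ i → χ (Z? (conj (enum i) ⁻¹ ∙ y))) ≡ χ (Conjugate? x y) * count (Centraliser? x)
      count-fibre y with Conjugate? x y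
      ... | no ¬conj = ≡.trans (sum-cong-≗ (λ i → χ-no (Z? _) (λ p → ¬conj (enum i , p))))
                               (≡.trans (sum-const {n} 0) (*-zeroʳ n))
      ... | yes (g₀ , p) = begin
        sum (λ i → χ (Z? (conj (enum i) ⁻¹ ∙ y)))  ≡⟨ sum-cong-≗ (λ i → χ-cong (conj-fibre→ p (enum i))
                                                                               (conj-fibre← p (enum i)) (Z? _) (Z? _)) ⟩
        sum (λ i → shifted (enum i))                ≡⟨ ∑-bijection (_∙ g₀) (_∙ g₀ ⁻¹) ∙g₀⁻¹∙g₀ ∙g₀∙g₀⁻¹ ∙-congʳ ∙-congʳ
                                                                  shifted (λ g≈h → χ-Centraliser-cong (∙-congʳ g≈h)) ⟩
        sum (λ i → shifted (enum i ∙ g₀))           ≡⟨ sum-cong-≗ (λ i → χ-Centraliser-cong (∙g₀∙g₀⁻¹ (enum i))) ⟩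
        count (Centraliser? x)                      ≡⟨ +-identityʳ _ ⟨
        1 * count (Centraliser? x)                  ∎
        where
        open ≡.≡-Reasoning
        shifted : Carrier → ℕ
        shifted g = χ (Centraliser? x (g ∙ g₀ ⁻¹))
        χ-Centraliser-cong : ∀ {g h} → g ≈ h → χ (Centraliser? x g) ≡ χ (Centraliser? x h)
        χ-Centraliser-cong g≈h = χ-cong (C-resp g≈h) (C-resp (sym g≈h)) (Z? _) (Z? _)
          where C-resp = IsSubgroup.∈-resp-≈ (Centraliser-isSubgroup x)
        ∙g₀⁻¹∙g₀ : ∀ g → g ∙ g₀ ⁻¹ ∙ g₀ ≈ g
        ∙g₀⁻¹∙g₀ g = solve (A ⊗ ι B ⊗ B) A ≡.refl (g ∷ g₀ ∷ [])
        ∙g₀∙g₀⁻¹ : ∀ g → g ∙ g₀ ∙ g₀ ⁻¹ ≈ g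
        ∙g₀∙g₀⁻¹ g = solve (A ⊗ B ⊗ ι B) A ≡.refl (g ∷ g₀ ∷ [])

      -- Count the pairs (g , y) with y ≡ conj g modulo Z by rows and by columns.
      orbit-stabiliser : n * count Z? ≡ count (Conjugate? x) * count (Centraliser? x)
      orbit-stabiliser = begin
        n * count Z?
          ≡⟨ sum-const {n} (count Z?) ⟨
        sum {n} (λ _ → count Z?)
          ≡⟨ sum-cong-≗ (λ i → count-coset Z-subgroup Z? (conj (enum i))) ⟨
        sum (λ i → sum (λ j → χ (Z? (conj (enum i) ⁻¹ ∙ enum j))))
          ≡⟨ ∑-comm (λ i j → χ (Z? (conj (enum i) ⁻¹ ∙ enum j))) ⟩
        sum (λ j → sum (λ i → χ (Z? (conj (enum i) ⁻¹ ∙ enum j))))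
          ≡⟨ sum-cong-≗ (λ j → count-fibre (enum j)) ⟩
        sum (λ j → χ (Conjugate? x (enum j)) * count (Centraliser? x))
          ≡⟨ sum-*ʳ (count (Centraliser? x)) (λ j → χ (Conjugate? x (enum j))) ⟩
        count (Conjugate? x) * count (Centraliser? x)
          ∎
        where open ≡.≡-Reasoning

    -- With |Z| = 2^s, every class outside the upper centre has size divisible by 2^(s+1) (its centraliser
    -- is proper), and so does n; hence 2^(s+1) divides |UpperCentre| ≥ |Z| > 0.
    module _ {k : ℕ} (n≡2^k : n ≡ 2 ^ k) (Z-proper : ¬ (∀ x → Z x)) where
      open PowersOfTwo
      open import Data.Nat.Properties using (<-≤-trans; m^n>0; ^-monoʳ-<; n<1+n)
      open import Data.Nat.Divisibility using (divides; ∣m+n∣m⇒∣n; ∣⇒≤)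
      open import Data.Nat using (>-nonZero)

      private
        order-Z : ∃ λ s → count Z? ≡ 2 ^ s × s < k
        order-Z = proper-subgroup-order n≡2^k Z-subgroup Z? Z-proper
        s : ℕ
        s = proj₁ order-Z

        #Z≡2^s : count Z? ≡ 2 ^ s
        #Z≡2^s = proj₁ (proj₂ order-Z)

        s<k : s < k
        s<k = proj₂ (proj₂ order-Z)

      2^1+s∣#class : ∀ x → ¬ UpperCentre x → 2 ^ suc s ∣ count (Conjugate? x)
      2^1+s∣#class x x∉Z⁺ with proper-subgroup-order n≡2^k (Centraliser-isSubgroup x) (Centraliser? x)
                                  (λ all → x∉Z⁺ (λ g → ⟦⟧-swap (all g)))
      ... | t , #C≡2^t , t<k = 2^1+s∣ (count (Conjugate? x)) t k s t<k (begin
        count (Conjugate? x) * 2 ^ t                   ≡⟨ ≡.cong (count (Conjugate? x) *_) #C≡2^t ⟨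
        count (Conjugate? x) * count (Centraliser? x) ≡⟨ orbit-stabiliser x ⟨
        n * count Z?                                   ≡⟨ ≡.cong₂ _*_ n≡2^k #Z≡2^s ⟩
        2 ^ k * 2 ^ s                                  ∎)
        where open ≡.≡-Reasoning

      2^1+s∣#UpperCentre : 2 ^ suc s ∣ count UpperCentre?
      2^1+s∣#UpperCentre = ∣m+n∣m⇒∣n 2^1+s∣n 2^1+s∣#outside
        where
        outside? = λ x → ¬? (UpperCentre? x)
        2^1+s∣#outside : 2 ^ suc s ∣ count outside?
        2^1+s∣#outside = ∣-count-of-classes Conjugate? Conjugate-isEquivalence (2 ^ suc s) outside?
                           (λ x∉Z⁺ x~y y∈Z⁺ → x∉Z⁺ (UpperCentre-closed x~y y∈Z⁺)) 2^1+s∣#class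
        2^1+s∣n : 2 ^ suc s ∣ count outside? + count UpperCentre?
        2^1+s∣n with 2^-split (suc s) k s<k
        ... | r , 2^k≡ = divides (2 ^ r)
              (≡.trans (≡.trans (+-comm (count outside?) _) (count-complement UpperCentre?)) (≡.trans n≡2^k 2^k≡))

      count-UpperCentre-grows : count Z? < count UpperCentre?
      count-UpperCentre-grows = ≡.subst (_< count UpperCentre?) (≡.sym #Z≡2^s)
        (<-≤-trans (^-monoʳ-< 2 (s≤s (s≤s z≤n)) (n<1+n s)) (∣⇒≤ ⦃ >-nonZero #Z⁺>0 ⦄ 2^1+s∣#UpperCentre))
        where
        #Z⁺>0 : 0 < count UpperCentre?
        #Z⁺>0 = <-≤-trans (≡.subst (0 <_) (≡.sym #Z≡2^s) (m^n>0 2 s)) (count-mono Z? UpperCentre? ⊆UpperCentre)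

  record DecidableNormal : Set (Level.suc (c ⊔ ℓ)) where
    field
      member   : Pred Carrier (c ⊔ ℓ)
      isNormal : IsNormal member
      decide   : Decidable member

  trivial-isNormal : IsNormal (_≈ ε)
  trivial-isNormal = record
    { isSubgroup = record
      { ∈-resp-≈  = λ x≈y x≈ε → trans (sym x≈y) x≈ε
      ; ε∈        = refl
      ; ∙-closed  = λ x≈ε y≈ε → trans (∙-cong x≈ε y≈ε) (identityʳ ε)
      ; ⁻¹-closed = λ {x} x≈ε → trans (⁻¹-cong x≈ε) (solve (ι e) e ≡.refl (x ∷ [])) }
    ; conj-closed = λ {x} g x≈ε → trans (∙-congʳ (∙-congˡ x≈ε)) (solve (ι A ⊗ e ⊗ A) e ≡.refl (g ∷ [])) }

  -- upperCentral j is the (j + 1)-st term Z_{j+1} of the upper central series.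
  upperCentral : ℕ → DecidableNormal
  upperCentral zero = record
    { member   = Centre.UpperCentre trivial-isNormal
    ; isNormal = Centre.UpperCentre-isNormal trivial-isNormal
    ; decide   = ClassEquationModulo.UpperCentre? trivial-isNormal (_≟ ε) }
  upperCentral (suc j) = record
    { member   = Centre.UpperCentre (isNormal (upperCentral j))
    ; isNormal = Centre.UpperCentre-isNormal (isNormal (upperCentral j))
    ; decide   = ClassEquationModulo.UpperCentre? (isNormal (upperCentral j)) (decide (upperCentral j)) }
    where open DecidableNormal

  module _ {k : ℕ} (n≡2^k : n ≡ 2 ^ k) where
    open DecidableNormal
    open import Data.Sum using (_⊎_; inj₁; inj₂)
    open import Data.Nat.Properties using (<-≤-trans; <⇒≱)

    Z : ℕ → Pred Carrier (c ⊔ ℓ)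
    Z j = member (upperCentral j)

    upperCentral-grows : ∀ j → (∀ x → Z j x) ⊎ (suc j ≤ count (decide (upperCentral j)))
    upperCentral-grows zero = inj₂ (≡.subst (_≤ count Z₁?) (χ-yes (Z₁? (enum (index ε))) ε∈Z₁)
                                              (sum-≥-term (λ i → χ (Z₁? (enum i))) (index ε)))
      where
      Z₁? = decide (upperCentral zero)
      ε∈Z₁ : Z zero (enum (index ε))
      ε∈Z₁ = IsNormal.∈-resp-≈ (isNormal (upperCentral zero)) (sym (enum-index ε))
                                (IsNormal.ε∈ (isNormal (upperCentral zero)))
    upperCentral-grows (suc j) with upperCentral-grows j
    ... | inj₁ all = inj₁ (λ x g → all ⟦ x , g ⟧)
    ... | inj₂ 1+j≤#Zj with all? (IsNormal.∈-resp-≈ (isNormal (upperCentral j))) (decide (upperCentral j))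
    ...   | yes all = inj₁ (λ x g → all ⟦ x , g ⟧)
    ...   | no ¬all = inj₂ (<-≤-trans (s≤s 1+j≤#Zj)
                             (ClassEquationModulo.count-UpperCentre-grows (isNormal (upperCentral j))
                                (decide (upperCentral j)) {k = k} n≡2^k ¬all))

    upperCentral-reaches-G : ∀ x → Z n x
    upperCentral-reaches-G with upperCentral-grows n
    ... | inj₁ all = all
    ... | inj₂ 1+n≤#Zn = ⊥-elim (<⇒≱ 1+n≤#Zn (count≤n (decide (upperCentral n))))

    -- N ⊆ Z_{j+1} gives [G, N] ⊆ Z_j, hence N ⊆ Z_j; descend from Z_{n+1} = G.
    ⊆[G,]⇒trivial : ∀ {q} {N : Pred Carrier q} → N ⊆ [G, N ] → N ⊆ (_≈ ε)
    ⊆[G,]⇒trivial {N = N} N⊆[G,N] = descend n (λ {x} _ → upperCentral-reaches-G x)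
      where
      descend : ∀ j → N ⊆ Z j → N ⊆ (_≈ ε)
      descend zero    N⊆Z₁   = Centre.[G,_]⊆ trivial-isNormal N⊆Z₁ ∘ N⊆[G,N]
      descend (suc j) N⊆Zj+2 = descend j (Centre.[G,_]⊆ (isNormal (upperCentral j)) N⊆Zj+2 ∘ N⊆[G,N])

module G32Facts where

  open PowerProducts
  open import Data.Bool using (Bool; true; false; _xor_)
  import Data.Bool.Properties as Bool
  open import Data.Vec using (Vec; []; _∷_)
  open import Relation.Binary.Definitions using (DecidableEquality)
  open import Relation.Binary.PropositionalEquality using (refl)
  open import Relation.Nullary using (Dec)
  open import Relation.Nullary.Decidable using (map′; _×-dec_; _→-dec_; toWitness)

  infix 4 _≟₃₂_
  _≟₃₂_ : DecidableEquality G32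
  g32 a b c d e ≟₃₂ g32 a′ b′ c′ d′ e′ =
    map′ (λ { (refl , refl , refl , refl , refl) → refl })
         (λ { refl → refl , refl , refl , refl , refl })
         (a Bool.≟ a′ ×-dec b Bool.≟ b′ ×-dec c Bool.≟ c′ ×-dec d Bool.≟ d′ ×-dec e Bool.≟ e′)

  all-Bool? : {P : Bool → Set} → (∀ b → Dec (P b)) → Dec (∀ b → P b)
  all-Bool? P? = map′ (λ { (Pt , Pf) → λ { true → Pt ; false → Pf } }) (λ all → all true , all false)
                      (P? true ×-dec P? false)

  all32? : {P : G32 → Set} → (∀ g → Dec (P g)) → Dec (∀ g → P g)
  all32? P? = map′ (λ all → λ { (g32 a b c d e) → all a b c d e }) (λ all a b c d e → all (g32 a b c d e))
                   (all-Bool? λ a → all-Bool? λ b → all-Bool? λ c → all-Bool? λ d → all-Bool? λ e → P? (g32 a b c d e))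

  central : Bool → Bool → G32
  central = g32 false false false

  -- The centre {(0 , w)} of 32.040, which is also its derived subgroup.
  Central : G32 → Set
  Central g = g ≡ central (G32.w1 g) (G32.w2 g)

  idempotent⇒e32 : ∀ g → g · g ≡ g → g ≡ e32
  idempotent⇒e32 = toWitness {a? = all32? λ g → (g · g ≟₃₂ g) →-dec (g ≟₃₂ e32)} _

  inv32-unique : ∀ u g → u · g ≡ e32 → u ≡ inv32 g
  inv32-unique = toWitness {a? = all32? λ u → all32? λ g → (u · g ≟₃₂ e32) →-dec (u ≟₃₂ inv32 g)} _

  comm32-central : ∀ u g → Central (comm32 u g)
  comm32-central = toWitness {a? = all32? λ u → all32? λ g → comm32 u g ≟₃₂ _} _

  ·-central : ∀ u g → Central u → Central g → Central (u · g)
  ·-central = toWitness {a? = all32? λ u → all32? λ g → (u ≟₃₂ _) →-dec ((g ≟₃₂ _) →-dec (u · g ≟₃₂ _))} _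

  inv32-central : ∀ g → Central g → Central (inv32 g)
  inv32-central = toWitness {a? = all32? λ g → (g ≟₃₂ _) →-dec (inv32 g ≟₃₂ _)} _

  generators : Vec G32 5
  generators = x1 ∷ x2 ∷ x3 ∷ x1 · x1 ∷ x3 · x3 ∷ []

  -- After x₁^a x₂^b x₃^c, the central coordinates are corrected by powers of x₁² = c₁₂ and x₃² = c₁₃.
  exponents : G32 → Vec Bool 5
  exponents g@(g32 a b c _ _) = a ∷ b ∷ c ∷ (G32.w1 g xor G32.w1 p) ∷ (G32.w2 g xor G32.w2 p) ∷ []
    where p = ∏ _·_ e32 (x1 ∷ x2 ∷ x3 ∷ []) (a ∷ b ∷ c ∷ [])

  normal-form : ∀ g → ∏ _·_ e32 generators (exponents g) ≡ g
  normal-form = toWitness {a? = all32? λ g → ∏ _·_ e32 generators (exponents g) ≟₃₂ g} _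

  central-normal-form : ∀ w₁ w₂ → ∏ _·_ e32 (x1 · x1 ∷ x3 · x3 ∷ []) (w₁ ∷ w₂ ∷ []) ≡ central w₁ w₂
  central-normal-form true  true  = refl
  central-normal-form true  false = refl
  central-normal-form false true  = refl
  central-normal-form false false = refl

module CommutatorsModuloG₄ {c ℓ : Level} (G : Group c ℓ) where
  open Group G
  open GroupNotions G
  open Subgroups G
  open FreeGroupWords
  open FreeGroupSolver G using (solve)
  open import Data.Vec using (_∷_; [])
  open import Relation.Unary using (Pred)
  import Relation.Binary.PropositionalEquality as ≡

  G₄ : Pred Carrier (c ⊔ ℓ)
  G₄ = [G, G₃ ]

  G₄-isNormal : IsNormal G₄
  G₄-isNormal = [G, G₃-isNormal ]-isNormal

  open Quotient G₄-isNormal renaming (_≈ₙ_ to _≈₄_)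
  private module H = Group quotientGroup
  open import Algebra.Properties.Group quotientGroup using (inverseˡ-unique)
  open import Relation.Binary.Reasoning.Setoid H.setoid

  ⟦G′,⟧∈G₃ : ∀ {s} x → Derived s → G₃ ⟦ s , x ⟧
  ⟦G′,⟧∈G₃ {s} x s∈G′ = resp (solve (ι (com A B)) (com B A) ≡.refl (x ∷ s ∷ [])) (inv (gen (x , s , s∈G′ , refl)))

  ⟦G₃,⟧≈ε : ∀ {t} x → G₃ t → ⟦ t , x ⟧ ≈₄ ε
  ⟦G₃,⟧≈ε x t∈G₃ = ∈⇒≈ₙε (Centre.⟦⟧-swap G₄-isNormal (gen (x , _ , t∈G₃ , refl)))

  G₃-central : ∀ {t} g → G₃ t → g ⁻¹ ∙ t ∙ g ≈₄ t
  G₃-central {t} g t∈G₃ = gen (g , t , t∈G₃ , solve (ι (ι A ⊗ B ⊗ A) ⊗ B) (com A B) ≡.refl (g ∷ t ∷ []))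

  ⟦∙,⟧≈ : ∀ {s} s′ x → Derived s → ⟦ s ∙ s′ , x ⟧ ≈₄ ⟦ s , x ⟧ ∙ ⟦ s′ , x ⟧
  ⟦∙,⟧≈ {s} s′ x s∈G′ = H.trans (≈⇒≈ₙ (Centre.⟦∙,⟧ G₄-isNormal s s′ x))
                                 (H.∙-cong (G₃-central s′ (⟦G′,⟧∈G₃ x s∈G′)) H.refl)

  ⟦⁻¹,⟧≈ : ∀ {s} x → Derived s → ⟦ s ⁻¹ , x ⟧ ≈₄ ⟦ s , x ⟧ ⁻¹
  ⟦⁻¹,⟧≈ {s} x s∈G′ = inverseˡ-unique _ _ (H.trans (H.sym (⟦∙,⟧≈ s x (inv s∈G′)))
                                                 (≈⇒≈ₙ (solve (com (ι A ⊗ A) B) e ≡.refl (s ∷ x ∷ []))))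

  ⟦⟧-cong-G₃ : ∀ {s s′} x → Derived s → G₃ (s ⁻¹ ∙ s′) → ⟦ s , x ⟧ ≈₄ ⟦ s′ , x ⟧
  ⟦⟧-cong-G₃ {s} {s′} x s∈G′ s≡s′ = H.sym (begin
    ⟦ s′ , x ⟧                        ≈⟨ ≈⇒≈ₙ (⟦⟧-cong (solve B (A ⊗ (ι A ⊗ B)) ≡.refl (s ∷ s′ ∷ [])) refl) ⟩
    ⟦ s ∙ (s ⁻¹ ∙ s′) , x ⟧          ≈⟨ ⟦∙,⟧≈ (s ⁻¹ ∙ s′) x s∈G′ ⟩
    ⟦ s , x ⟧ ∙ ⟦ s ⁻¹ ∙ s′ , x ⟧    ≈⟨ H.∙-cong H.refl (⟦G₃,⟧≈ε x s≡s′) ⟩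
    ⟦ s , x ⟧ ∙ ε                     ≈⟨ H.identityʳ _ ⟩
    ⟦ s , x ⟧                         ∎)

  ⟦x²,y⟧∙⟦y²,x⟧≈ : ∀ x y → ⟦ x ∙ x , y ⟧ ∙ ⟦ y ∙ y , x ⟧ ≈₄ ⟦ ⟦ x , y ⟧ , x ⟧ ∙ ⟦ ⟦ x , y ⟧ ⁻¹ , y ⟧
  ⟦x²,y⟧∙⟦y²,x⟧≈ x y = H.trans
    (≈⇒≈ₙ (solve (com (A ⊗ A) B ⊗ com (B ⊗ B) A)
                 (ι (ι (com A B)) ⊗ (com (com A B) A ⊗ com (ι (com A B)) B) ⊗ ι (com A B)) ≡.refl (x ∷ y ∷ [])))
    (G₃-central (⟦ x , y ⟧ ⁻¹) (mul (⟦G′,⟧∈G₃ x [x,y]∈G′) (⟦G′,⟧∈G₃ y (inv [x,y]∈G′))))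
    where
    [x,y]∈G′ : Derived ⟦ x , y ⟧
    [x,y]∈G′ = gen (x , y , refl)

  ⟦x²,x⟧≈ε : ∀ x → ⟦ x ∙ x , x ⟧ ≈₄ ε
  ⟦x²,x⟧≈ε x = ≈⇒≈ₙ (solve (com (A ⊗ A) A) e ≡.refl (x ∷ []))

module Quotient32040 {c ℓ : Level} (G : Group c ℓ) (φ : GroupNotions.QuotientIso G (GroupNotions.G₃ G) G32 _·_) where
  open Group G
  open GroupNotions G
  open QuotientIso φ
  open Subgroups G
  open CommutatorsModuloG₄ G
  open FreeGroupWords
  open FreeGroupSolver G using (solve)
  open PowerProducts
  open G32Facts
  open import Data.Bool using (true; false)
  open import Function using (_∘_)
  open import Data.Vec using (Vec; []; _∷_; map)
  open import Data.Vec.Relation.Unary.All using (All; []; _∷_)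
  open import Data.Product using (_,_; proj₁; proj₂)
  open import Relation.Unary using (Pred; _⊆_)
  open import Relation.Binary.PropositionalEquality as ≡ using (cong; cong₂)

  f-resp : ∀ {x y} → x ≈ y → f x ≡ f y
  f-resp {x} {y} x≈y = wd x y (resp (trans (sym (inverseˡ x)) (∙-congˡ x≈y)) one)

  f-ε : f ε ≡ e32
  f-ε = idempotent⇒e32 (f ε) (≡.trans (≡.sym (hom ε ε)) (f-resp (identityʳ ε)))

  f-⁻¹ : ∀ x → f (x ⁻¹) ≡ inv32 (f x)
  f-⁻¹ x = inv32-unique (f (x ⁻¹)) (f x) (≡.trans (≡.sym (hom (x ⁻¹) x)) (≡.trans (f-resp (inverseˡ x)) f-ε))

  f-⟦⟧ : ∀ x y → f ⟦ x , y ⟧ ≡ comm32 (f x) (f y)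
  f-⟦⟧ x y = begin
    f (x ⁻¹ ∙ y ⁻¹ ∙ x ∙ y)                 ≡⟨ hom _ y ⟩
    f (x ⁻¹ ∙ y ⁻¹ ∙ x) · f y               ≡⟨ cong (_· f y) (hom _ x) ⟩
    f (x ⁻¹ ∙ y ⁻¹) · f x · f y             ≡⟨ cong (λ z → z · f x · f y) (hom (x ⁻¹) (y ⁻¹)) ⟩
    f (x ⁻¹) · f (y ⁻¹) · f x · f y         ≡⟨ cong₂ (λ u v → u · v · f x · f y) (f-⁻¹ x) (f-⁻¹ y) ⟩
    inv32 (f x) · inv32 (f y) · f x · f y   ∎
    where open ≡.≡-Reasoning

  f-∏ : ∀ {m} (xs : Vec Carrier m) bs → f (∏ _∙_ ε xs bs) ≡ ∏ _·_ e32 (map f xs) bs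
  f-∏ []       []           = f-ε
  f-∏ (x ∷ xs) (true ∷ bs)  = ≡.trans (hom x _) (cong (f x ·_) (f-∏ xs bs))
  f-∏ (x ∷ xs) (false ∷ bs) = f-∏ xs bs

  Derived⇒Central : Derived ⊆ (Central ∘ f)
  Derived⇒Central (gen {x} (a , b , x≈[a,b])) =
    ≡.subst Central (≡.sym (≡.trans (f-resp x≈[a,b]) (f-⟦⟧ a b))) (comm32-central (f a) (f b))
  Derived⇒Central one = ≡.subst Central (≡.sym f-ε) ≡.refl
  Derived⇒Central (mul {x} {y} p q) =
    ≡.subst Central (≡.sym (hom x y)) (·-central (f x) (f y) (Derived⇒Central p) (Derived⇒Central q))
  Derived⇒Central (inv {x} p) = ≡.subst Central (≡.sym (f-⁻¹ x)) (inv32-central (f x) (Derived⇒Central p))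
  Derived⇒Central (resp x≈y p) = ≡.subst Central (f-resp x≈y) (Derived⇒Central p)

  a₁ a₂ a₃ : Carrier
  a₁ = proj₁ (surj x1)
  a₂ = proj₁ (surj x2)
  a₃ = proj₁ (surj x3)

  f-a₁ : f a₁ ≡ x1
  f-a₁ = proj₂ (surj x1)
  f-a₂ : f a₂ ≡ x2
  f-a₂ = proj₂ (surj x2)
  f-a₃ : f a₃ ≡ x3
  f-a₃ = proj₂ (surj x3)

  -- P and Q lift c₁₂ = x₁² and c₁₃ = x₃².
  P Q : Carrier
  P = a₁ ∙ a₁
  Q = a₃ ∙ a₃

  f-P : f P ≡ x1 · x1
  f-P = ≡.trans (hom a₁ a₁) (cong₂ _·_ f-a₁ f-a₁)
  f-Q : f Q ≡ x3 · x3
  f-Q = ≡.trans (hom a₃ a₃) (cong₂ _·_ f-a₃ f-a₃)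

  lifts : Vec Carrier 5
  lifts = a₁ ∷ a₂ ∷ a₃ ∷ P ∷ Q ∷ []

  map-f-lifts : map f lifts ≡ generators
  map-f-lifts rewrite f-a₁ | f-a₂ | f-a₃ | f-P | f-Q = ≡.refl

  module _ {q} {S : Pred Carrier q} (S-subgroup : IsSubgroup S) (G₃⊆S : G₃ ⊆ S) where
    open IsSubgroup S-subgroup

    ∈-by-image : ∀ {s x} → S s → f s ≡ f x → S x
    ∈-by-image {s} {x} Ss fs≡fx =
      ∈-resp-≈ (solve (A ⊗ (ι A ⊗ B)) B ≡.refl (s ∷ x ∷ [])) (∙-closed Ss (G₃⊆S (inj s x fs≡fx)))

    generated-by-lifts : S a₁ → S a₂ → S a₃ → ∀ x → S x
    generated-by-lifts Sa₁ Sa₂ Sa₃ x = ∈-by-image (∏-closed S-subgroup S-lifts bs) (begin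
      f (∏ _∙_ ε lifts bs)            ≡⟨ f-∏ lifts bs ⟩
      ∏ _·_ e32 (map f lifts) bs      ≡⟨ cong (λ gs → ∏ _·_ e32 gs bs) map-f-lifts ⟩
      ∏ _·_ e32 generators bs         ≡⟨ normal-form (f x) ⟩
      f x                             ∎)
      where
      open ≡.≡-Reasoning
      bs = exponents (f x)
      S-lifts : All S lifts
      S-lifts = Sa₁ ∷ Sa₂ ∷ Sa₃ ∷ ∙-closed Sa₁ Sa₁ ∷ ∙-closed Sa₃ Sa₃ ∷ []

    derived-generated : S P → S Q → Derived ⊆ S
    derived-generated SP SQ {h} h∈G′ = ∈-by-image (∏-closed S-subgroup (SP ∷ SQ ∷ []) ws) (begin
      f (∏ _∙_ ε (P ∷ Q ∷ []) ws)                  ≡⟨ f-∏ (P ∷ Q ∷ []) ws ⟩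
      ∏ _·_ e32 (f P ∷ f Q ∷ []) ws                ≡⟨ cong₂ (λ u v → ∏ _·_ e32 (u ∷ v ∷ []) ws) f-P f-Q ⟩
      ∏ _·_ e32 (x1 · x1 ∷ x3 · x3 ∷ []) ws        ≡⟨ central-normal-form (G32.w1 (f h)) (G32.w2 (f h)) ⟩
      central (G32.w1 (f h)) (G32.w2 (f h))        ≡⟨ Derived⇒Central h∈G′ ⟨
      f h                                          ∎)
      where
      open ≡.≡-Reasoning
      ws = G32.w1 (f h) ∷ G32.w2 (f h) ∷ []

  f-⟦⟧-lifts : ∀ {x y u v} → f x ≡ u → f y ≡ v → f ⟦ x , y ⟧ ≡ comm32 u v
  f-⟦⟧-lifts fx≡u fy≡v = ≡.trans (f-⟦⟧ _ _) (cong₂ comm32 fx≡u fy≡v)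

  P≡[a₁,a₂] : G₃ (P ⁻¹ ∙ ⟦ a₁ , a₂ ⟧)
  P≡[a₁,a₂] = inj P _ (≡.trans f-P (≡.sym (f-⟦⟧-lifts f-a₁ f-a₂)))

  Q≡[a₁,a₃] : G₃ (Q ⁻¹ ∙ ⟦ a₁ , a₃ ⟧)
  Q≡[a₁,a₃] = inj Q _ (≡.trans f-Q (≡.sym (f-⟦⟧-lifts f-a₁ f-a₃)))

  [a₂,a₃]∈G₃ : G₃ ⟦ a₂ , a₃ ⟧
  [a₂,a₃]∈G₃ = resp (solve (ι e ⊗ A) A ≡.refl (⟦ a₂ , a₃ ⟧ ∷ []))
                    (inj ε _ (≡.trans f-ε (≡.sym (f-⟦⟧-lifts f-a₂ f-a₃))))

  a₂²≡PQ : G₃ ((P ∙ Q) ⁻¹ ∙ (a₂ ∙ a₂))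
  a₂²≡PQ = inj (P ∙ Q) (a₂ ∙ a₂)
    (≡.trans (hom P Q) (≡.trans (cong₂ _·_ f-P f-Q) (≡.sym (≡.trans (hom a₂ a₂) (cong₂ _·_ f-a₂ f-a₂)))))

  P∈G′ : Derived P
  P∈G′ = ∈-by-image (Closure-isSubgroup _) G₃⊆Derived (gen (a₁ , a₂ , refl)) (≡.trans (f-⟦⟧-lifts f-a₁ f-a₂) (≡.sym f-P))

  Q∈G′ : Derived Q
  Q∈G′ = ∈-by-image (Closure-isSubgroup _) G₃⊆Derived (gen (a₁ , a₃ , refl)) (≡.trans (f-⟦⟧-lifts f-a₁ f-a₃) (≡.sym f-Q))

  module Relations where
    open Quotient G₄-isNormal renaming (_≈ₙ_ to _≈₄_)
    module H = Group quotientGroup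
    open import Algebra.Properties.Group quotientGroup using (identityˡ-unique; ε⁻¹≈ε)
    open import Relation.Binary.Reasoning.Setoid H.setoid

    ⟦[a₁,a₂],⟧≈ : ∀ x → ⟦ ⟦ a₁ , a₂ ⟧ , x ⟧ ≈₄ ⟦ P , x ⟧
    ⟦[a₁,a₂],⟧≈ x = H.sym (⟦⟧-cong-G₃ x P∈G′ P≡[a₁,a₂])

    ⟦[a₁,a₃],⟧≈ : ∀ x → ⟦ ⟦ a₁ , a₃ ⟧ , x ⟧ ≈₄ ⟦ Q , x ⟧
    ⟦[a₁,a₃],⟧≈ x = H.sym (⟦⟧-cong-G₃ x Q∈G′ Q≡[a₁,a₃])

    ⟦a₂²,⟧≈ : ∀ x → ⟦ a₂ ∙ a₂ , x ⟧ ≈₄ ⟦ P , x ⟧ ∙ ⟦ Q , x ⟧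
    ⟦a₂²,⟧≈ x = H.trans (H.sym (⟦⟧-cong-G₃ x (mul P∈G′ Q∈G′) a₂²≡PQ)) (⟦∙,⟧≈ Q x P∈G′)

    ⟦P,a₂⟧∙⟦Q,a₂⟧≈ε : ⟦ P , a₂ ⟧ ∙ ⟦ Q , a₂ ⟧ ≈₄ ε
    ⟦P,a₂⟧∙⟦Q,a₂⟧≈ε = H.trans (H.sym (⟦a₂²,⟧≈ a₂)) (⟦x²,x⟧≈ε a₂)

    ⟦P,a₃⟧≈ε : ⟦ P , a₃ ⟧ ≈₄ ε
    ⟦P,a₃⟧≈ε = identityˡ-unique _ _ (begin
      ⟦ P , a₃ ⟧ ∙ ⟦ Q , a₁ ⟧                          ≈⟨ ⟦x²,y⟧∙⟦y²,x⟧≈ a₁ a₃ ⟩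
      ⟦ ⟦ a₁ , a₃ ⟧ , a₁ ⟧ ∙ ⟦ ⟦ a₁ , a₃ ⟧ ⁻¹ , a₃ ⟧  ≈⟨ H.∙-cong (⟦[a₁,a₃],⟧≈ a₁) (⟦⁻¹,⟧≈ a₃ (gen (a₁ , a₃ , refl))) ⟩
      ⟦ Q , a₁ ⟧ ∙ ⟦ ⟦ a₁ , a₃ ⟧ , a₃ ⟧ ⁻¹            ≈⟨ H.∙-cong H.refl (H.⁻¹-cong [[a₁,a₃],a₃]≈ε) ⟩
      ⟦ Q , a₁ ⟧ ∙ ε ⁻¹                                ≈⟨ H.∙-cong H.refl ε⁻¹≈ε ⟩
      ⟦ Q , a₁ ⟧ ∙ ε                                   ≈⟨ H.identityʳ _ ⟩
      ⟦ Q , a₁ ⟧                                       ∎)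
      where
      [[a₁,a₃],a₃]≈ε : ⟦ ⟦ a₁ , a₃ ⟧ , a₃ ⟧ ≈₄ ε
      [[a₁,a₃],a₃]≈ε = H.trans (⟦[a₁,a₃],⟧≈ a₃) (⟦x²,x⟧≈ε a₃)

    ⟦Q,a₂⟧≈ε : ⟦ Q , a₂ ⟧ ≈₄ ε
    ⟦Q,a₂⟧≈ε = begin
      ⟦ Q , a₂ ⟧                                       ≈⟨ H.identityˡ _ ⟨
      ε ∙ ⟦ Q , a₂ ⟧                                   ≈⟨ H.∙-cong ⟦a₂²,a₃⟧≈ε H.refl ⟨
      ⟦ a₂ ∙ a₂ , a₃ ⟧ ∙ ⟦ Q , a₂ ⟧                    ≈⟨ ⟦x²,y⟧∙⟦y²,x⟧≈ a₂ a₃ ⟩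
      ⟦ ⟦ a₂ , a₃ ⟧ , a₂ ⟧ ∙ ⟦ ⟦ a₂ , a₃ ⟧ ⁻¹ , a₃ ⟧  ≈⟨ H.∙-cong (⟦G₃,⟧≈ε a₂ [a₂,a₃]∈G₃) (⟦G₃,⟧≈ε a₃ (inv [a₂,a₃]∈G₃)) ⟩
      ε ∙ ε                                            ≈⟨ H.identityʳ ε ⟩
      ε                                                ∎
      where
      ⟦a₂²,a₃⟧≈ε : ⟦ a₂ ∙ a₂ , a₃ ⟧ ≈₄ ε
      ⟦a₂²,a₃⟧≈ε = H.trans (⟦a₂²,⟧≈ a₃) (H.trans (H.∙-cong ⟦P,a₃⟧≈ε (⟦x²,x⟧≈ε a₃)) (H.identityʳ ε))

    ⟦P,a₂⟧≈ε : ⟦ P , a₂ ⟧ ≈₄ ε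
    ⟦P,a₂⟧≈ε = H.trans (H.sym (H.trans (H.∙-cong H.refl ⟦Q,a₂⟧≈ε) (H.identityʳ _))) ⟦P,a₂⟧∙⟦Q,a₂⟧≈ε

    ⟦Q,a₁⟧≈ε : ⟦ Q , a₁ ⟧ ≈₄ ε
    ⟦Q,a₁⟧≈ε = begin
      ⟦ Q , a₁ ⟧                                       ≈⟨ H.trans (H.identityˡ _) (H.identityˡ _) ⟨
      ε ∙ (ε ∙ ⟦ Q , a₁ ⟧)                             ≈⟨ H.∙-cong ⟦P,a₂⟧≈ε (H.∙-cong (⟦x²,x⟧≈ε a₁) H.refl) ⟨
      ⟦ P , a₂ ⟧ ∙ (⟦ P , a₁ ⟧ ∙ ⟦ Q , a₁ ⟧)           ≈⟨ H.∙-cong H.refl (⟦a₂²,⟧≈ a₁) ⟨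
      ⟦ P , a₂ ⟧ ∙ ⟦ a₂ ∙ a₂ , a₁ ⟧                    ≈⟨ ⟦x²,y⟧∙⟦y²,x⟧≈ a₁ a₂ ⟩
      ⟦ ⟦ a₁ , a₂ ⟧ , a₁ ⟧ ∙ ⟦ ⟦ a₁ , a₂ ⟧ ⁻¹ , a₂ ⟧  ≈⟨ H.∙-cong (⟦[a₁,a₂],⟧≈ a₁) (⟦⁻¹,⟧≈ a₂ (gen (a₁ , a₂ , refl))) ⟩
      ⟦ P , a₁ ⟧ ∙ ⟦ ⟦ a₁ , a₂ ⟧ , a₂ ⟧ ⁻¹            ≈⟨ H.∙-cong (⟦x²,x⟧≈ε a₁) (H.⁻¹-cong (H.trans (⟦[a₁,a₂],⟧≈ a₂) ⟦P,a₂⟧≈ε)) ⟩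
      ε ∙ ε ⁻¹                                         ≈⟨ H.inverseʳ ε ⟩
      ε                                                ∎

  open Centre G₄-isNormal
  open Quotient G₄-isNormal using (≈ₙε⇒∈)
  open Relations using (⟦P,a₂⟧≈ε; ⟦P,a₃⟧≈ε; ⟦Q,a₁⟧≈ε; ⟦Q,a₂⟧≈ε)

  G₃⊆UpperCentre : G₃ ⊆ UpperCentre
  G₃⊆UpperCentre t∈G₃ g = ⟦⟧-swap (gen (g , _ , t∈G₃ , refl))

  central-by-lifts : ∀ {s} → (∀ {x} → G₃ x → G₄ ⟦ s , x ⟧) →
                     G₄ ⟦ s , a₁ ⟧ → G₄ ⟦ s , a₂ ⟧ → G₄ ⟦ s , a₃ ⟧ → UpperCentre s
  central-by-lifts {s} G₃-commutes s-a₁ s-a₂ s-a₃ x =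
    ⟦⟧-swap (generated-by-lifts (Centraliser-isSubgroup s) (⟦⟧-swap ∘ G₃-commutes)
                                (⟦⟧-swap s-a₁) (⟦⟧-swap s-a₂) (⟦⟧-swap s-a₃) x)

  P-central : UpperCentre P
  P-central = central-by-lifts (λ t∈G₃ → gen (P , _ , t∈G₃ , refl))
                (≈ₙε⇒∈ (⟦x²,x⟧≈ε a₁)) (≈ₙε⇒∈ ⟦P,a₂⟧≈ε) (≈ₙε⇒∈ ⟦P,a₃⟧≈ε)

  Q-central : UpperCentre Q
  Q-central = central-by-lifts (λ t∈G₃ → gen (Q , _ , t∈G₃ , refl))
                (≈ₙε⇒∈ ⟦Q,a₁⟧≈ε) (≈ₙε⇒∈ ⟦Q,a₂⟧≈ε) (≈ₙε⇒∈ (⟦x²,x⟧≈ε a₃))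

  G₃⊆[G,G₃] : G₃ ⊆ [G, G₃ ]
  G₃⊆[G,G₃] = [G, derived-generated (IsNormal.isSubgroup UpperCentre-isNormal) G₃⊆UpperCentre P-central Q-central ]⊆

proposition5 : ∀ {c ℓ : Level} (G : Group c ℓ) →
    let open Group G
        open GroupNotions G
    in IsFinite2Group →
       QuotientIso G₃ G32 _·_ →
       ∀ x → G₃ x → x ≈ ε
proposition5 G (k , enum , enum-injective , enum-surjective) φ x x∈G₃ =
  Counting.⊆[G,]⇒trivial G enum enum-injective enum-surjective {k = k} ≡.refl (Quotient32040.G₃⊆[G,G₃] G φ) x∈G₃
  where import Relation.Binary.PropositionalEquality as ≡
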